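{- Let $q>2$ be even and let $\mathcal{E}$ be a set of solids of $\mathrm{PG}(4,q)$ such that every point of $\mathrm{PG}(4,q)$ lies in either $0$, $\frac12q^3$ or $\frac12(q^3-q^2)$ solids of $\mathcal{E}$, and every plane lies in either $0$, $\frac12q$ or $q$ solids of $\mathcal{E}$. Let $\mathsf e=|\mathcal{E}|/(\frac12q^2)$. Then every solid in $\mathcal{E}$ contains exactly $s$ black points, where $s+q=(q^2-\mathsf e)(q^2+q+1)$.
   Context: A solid of $\mathrm{PG}(4,q)$ is a hyperplane. A point is called red if it lies in $0$ solids of $\mathcal{E}$, white if it lies in $\frac12q^3$ solids of $\mathcal{E}$, and black if it lies in $\frac12(q^3-q^2)$ solids of $\mathcal{E}$. -}

module Defs where

open import Data.Nat using (ℕ; zero; suc)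
open import Data.Bool using (Bool; true; false; _∧_; not)
open import Data.List using (List; []; _∷_; [_]; map; concatMap; length; filterᵇ)
open import Data.List.Membership.Propositional using (_∈_)
open import Data.List.Relation.Unary.Unique.Propositional using (Unique)
open import Data.Vec using (Vec; []; _∷_; zipWith; replicate; foldr)
open import Data.Product using (∃; _×_)
open import Relation.Nullary using (does)
open import Relation.Binary.PropositionalEquality using (_≡_; _≢_)
open import Relation.Binary.Definitions using (DecidableEquality)
open import Algebra.Core using (Op₁; Op₂)
open import Algebra.Structures using (IsCommutativeRing)

record FiniteField (q : ℕ) : Set₁ where
  field
    Carrier : Set
    _+_ _*_ : Op₂ Carrier
    -_ : Op₁ Carrier
    0# 1# : Carrier
    isCommutativeRing : IsCommutativeRing _≡_ _+_ _*_ -_ 0# 1#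
    0≢1 : 0# ≢ 1#
    inverse : ∀ x → x ≢ 0# → ∃ λ y → (x * y) ≡ 1#
    _≟_ : DecidableEquality Carrier
    elements : List Carrier
    complete : ∀ x → x ∈ elements
    unique : Unique elements
    size : length elements ≡ q

-- The projective space PG(n-1,q) = PG(V) with V = F^n.
module PG {q : ℕ} (F : FiniteField q) where
  open FiniteField F

  Vector : ℕ → Set
  Vector n = Vec Carrier n

  allVecs : (n : ℕ) → List (Vector n)
  allVecs zero = [ [] ]
  allVecs (suc n) = concatMap (λ x → map (x ∷_) (allVecs n)) elements

  count : (n : ℕ) → (Vector n → Bool) → ℕ
  count n P = length (filterᵇ P (allVecs n))

  isZero : Carrier → Bool
  isZero x = does (x ≟ 0#)

  -- canonical representative of a 1-dim subspace: nonzero vector whose first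
  -- nonzero coordinate equals 1.  Points (and, dually, hyperplanes) of PG(V)
  -- are in bijection with such vectors.
  normalized : {n : ℕ} → Vector n → Bool
  normalized [] = false
  normalized (x ∷ xs) with x ≟ 0#
  ... | Relation.Nullary.yes _ = normalized xs
  ... | Relation.Nullary.no _ = does (x ≟ 1#)

  dot : {n : ℕ} → Vector n → Vector n → Carrier
  dot u v = foldr _ _+_ 0# (zipWith _*_ u v)

  -- hyperplane with normalized dual coordinates a contains point with coordinates x
  incident : {n : ℕ} → Vector n → Vector n → Bool
  incident a x = isZero (dot a x)

  scale : {n : ℕ} → Carrier → Vector n → Vector n
  scale c v = Data.Vec.map (c *_) v

  vadd : {n : ℕ} → Vector n → Vector n → Vector n
  vadd = zipWith _+_

  Independent3 : {n : ℕ} → Vector n → Vector n → Vector n → Set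
  Independent3 {n} u v w = ∀ l m k →
    vadd (scale l u) (vadd (scale m v) (scale k w)) ≡ replicate n 0# →
    (l ≡ 0#) × (m ≡ 0#) × (k ≡ 0#)

  -- In PG(4,q): points and solids are normalized vectors of F^5.
  -- A set of solids is given by a boolean predicate on normalized dual vectors.

  numSolids : (Vector 5 → Bool) → ℕ
  numSolids E = count 5 (λ a → normalized a ∧ E a)

  solidsThroughPoint : (Vector 5 → Bool) → Vector 5 → ℕ
  solidsThroughPoint E x = count 5 (λ a → normalized a ∧ E a ∧ incident a x)

  solidsThroughPlane : (Vector 5 → Bool) → Vector 5 → Vector 5 → Vector 5 → ℕ
  solidsThroughPlane E u v w =
    count 5 (λ a → normalized a ∧ E a ∧ incident a u ∧ incident a v ∧ incident a w)

  isBlack : (Vector 5 → Bool) → Vector 5 → Bool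
  isBlack E x = does (solidsThroughPoint E x Data.Nat.≟
                       Data.Nat._/_ (q Data.Nat.^ 3 Data.Nat.∸ q Data.Nat.^ 2) 2)

  blackPointsIn : (Vector 5 → Bool) → Vector 5 → ℕ
  blackPointsIn E a = count 5 (λ x → normalized x ∧ incident a x ∧ isBlack E x)

module Submission where

-- Proof: double count the pairs (x, b) with x a point of a and b ∈ E through x.  Every
-- other solid of E meets a in a plane, so there are |E| θ₂ + q³ pairs, θₘ = |PG(m,q)|.
-- Every point of a lies in a ∈ E, hence is white or black, so it lies in W - G [x black]
-- solids with G = W - B = q²/2; summing gives |E| θ₂ + q³ + G s = W θ₃, which rearranges
-- to the claim.

open import Defs

open import Data.Nat as ℕ using (ℕ; zero; suc; _+_; _*_; _^_; _≤_; NonZero)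
import Data.Nat.Properties as ℕP
import Data.Nat.DivMod as ℕD
open import Data.Bool using (Bool; true; false; _∧_; not)
open import Data.Bool.Properties using (∧-idem)
open import Algebra.Properties.CommutativeSemigroup ℕP.+-commutativeSemigroup
  using () renaming (interchange to +-interchange)
open import Algebra.Properties.CommutativeSemigroup ℕP.*-commutativeSemigroup
  using () renaming (x∙yz≈y∙xz to *-left-commute)
open import Data.List using (List; []; _∷_; map; concatMap; length; filterᵇ; _++_)
open import Data.List.Membership.Propositional using (_∈_)
open import Data.List.Relation.Unary.Any using (here; there)
open import Data.List.Relation.Unary.All using (All; []; _∷_)
open import Data.List.Relation.Unary.AllPairs using (_∷_)
open import Data.List.Relation.Unary.Unique.Propositional using (Unique)
open import Data.Empty using (⊥; ⊥-elim)
open import Data.Product using (∃; _×_; _,_; proj₁; proj₂)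
open import Data.Sum using (_⊎_; inj₁; inj₂)
open import Data.Vec using (Vec; []; _∷_; replicate)
open import Data.Vec.Properties using (≡-dec)
open import Level using (0ℓ)
open import Algebra.Bundles using (CommutativeRing)
open import Algebra.Structures using (IsCommutativeRing)
open import Function.Bundles using (mk⇔)
open import Relation.Nullary using (does; yes; no)
open import Relation.Nullary.Decidable using (dec-true; dec-false; does-⇔)
open import Relation.Binary.Definitions using (DecidableEquality)
open import Relation.Binary.PropositionalEquality
  using (_≡_; _≢_; refl; sym; trans; cong; cong₂; subst; module ≡-Reasoning)

[_] : Bool → ℕ
[ true ] = 1
[ false ] = 0

[∧] : ∀ b c → [ b ∧ c ] ≡ [ b ] * [ c ]
[∧] true c = sym (ℕP.+-identityʳ [ c ])
[∧] false c = refl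

module _ {A : Set} where

  Σ : List A → (A → ℕ) → ℕ
  Σ [] f = 0
  Σ (x ∷ xs) f = f x + Σ xs f

  Σ-cong : ∀ L {f g : A → ℕ} → (∀ x → f x ≡ g x) → Σ L f ≡ Σ L g
  Σ-cong [] e = refl
  Σ-cong (x ∷ L) e = cong₂ _+_ (e x) (Σ-cong L e)

  Σ-+ : ∀ L (f g : A → ℕ) → Σ L (λ x → f x + g x) ≡ Σ L f + Σ L g
  Σ-+ [] f g = refl
  Σ-+ (x ∷ L) f g = trans (cong (f x + g x +_) (Σ-+ L f g)) (+-interchange (f x) (g x) (Σ L f) (Σ L g))

  Σ-*ˡ : ∀ L c (f : A → ℕ) → Σ L (λ x → c * f x) ≡ c * Σ L f
  Σ-*ˡ [] c f = sym (ℕP.*-zeroʳ c)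
  Σ-*ˡ (x ∷ L) c f = trans (cong (c * f x +_) (Σ-*ˡ L c f)) (sym (ℕP.*-distribˡ-+ c (f x) (Σ L f)))

  Σ-*ʳ : ∀ L c (f : A → ℕ) → Σ L (λ x → f x * c) ≡ Σ L f * c
  Σ-*ʳ L c f = trans (Σ-cong L (λ x → ℕP.*-comm (f x) c)) (trans (Σ-*ˡ L c f) (ℕP.*-comm c (Σ L f)))

  Σ-const : ∀ L c → Σ L (λ _ → c) ≡ length L * c
  Σ-const [] c = refl
  Σ-const (x ∷ L) c = cong (c +_) (Σ-const L c)

  Σ-++ : ∀ L M (f : A → ℕ) → Σ (L ++ M) f ≡ Σ L f + Σ M f
  Σ-++ [] M f = refl
  Σ-++ (x ∷ L) M f = trans (cong (f x +_) (Σ-++ L M f)) (sym (ℕP.+-assoc (f x) _ _))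

  Σ-mono : ∀ L {f g : A → ℕ} → (∀ x → f x ≤ g x) → Σ L f ≤ Σ L g
  Σ-mono [] le = ℕ.z≤n
  Σ-mono (x ∷ L) le = ℕP.+-mono-≤ (le x) (Σ-mono L le)

  length-filter : ∀ (P : A → Bool) L → length (filterᵇ P L) ≡ Σ L (λ x → [ P x ])
  length-filter P [] = refl
  length-filter P (x ∷ L) with P x
  ... | true = cong suc (length-filter P L)
  ... | false = length-filter P L

module _ {A B : Set} where

  Σ-map : ∀ L (h : A → B) (f : B → ℕ) → Σ (map h L) f ≡ Σ L (λ x → f (h x))
  Σ-map [] h f = refl
  Σ-map (x ∷ L) h f = cong (f (h x) +_) (Σ-map L h f)

  Σ-concatMap : ∀ L (h : A → List B) (f : B → ℕ) →
    Σ (concatMap h L) f ≡ Σ L (λ x → Σ (h x) f)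
  Σ-concatMap [] h f = refl
  Σ-concatMap (x ∷ L) h f =
    trans (Σ-++ (h x) (concatMap h L) f) (cong (Σ (h x) f +_) (Σ-concatMap L h f))

  Σ-swap : ∀ (L : List A) (M : List B) (f : A → B → ℕ) →
    Σ L (λ x → Σ M (f x)) ≡ Σ M (λ y → Σ L (λ x → f x y))
  Σ-swap [] M f = sym (Σ-zero M)
    where
    Σ-zero : ∀ (M : List B) → Σ M (λ _ → 0) ≡ 0
    Σ-zero [] = refl
    Σ-zero (_ ∷ M) = Σ-zero M
  Σ-swap (x ∷ L) M f =
    trans (cong (Σ M (f x) +_) (Σ-swap L M f)) (sym (Σ-+ M (f x) (λ y → Σ L (λ x' → f x' y))))

-- Sums over a list L that enumerates a type A with decidable equality.
-- "L enumerates A" is expressed by the sifting property of the Kronecker delta: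
-- summing δ x y * g x over L picks out g y, i.e. each y occurs exactly once in L.
module Enumeration {A : Set} (_≟_ : DecidableEquality A) where

  δ : A → A → ℕ
  δ x y = [ does (x ≟ y) ]

  δ-sym : ∀ x y → δ x y ≡ δ y x
  δ-sym x y = cong [_] (does-⇔ (mk⇔ sym sym) (x ≟ y) (y ≟ x))

  record Enumerates (L : List A) : Set where
    constructor enumerates
    field sift : ∀ (g : A → ℕ) y → Σ L (λ x → δ x y * g x) ≡ g y
  open Enumerates public

  unique-complete-enumerates : ∀ L → Unique L → (∀ y → y ∈ L) → Enumerates L
  unique-complete-enumerates L u c = enumerates (λ g y → sift-unique g y L u (c y))
    where
    absent : ∀ (g : A → ℕ) y L → All (y ≢_) L → Σ L (λ x → δ x y * g x) ≡ 0
    absent g y [] [] = refl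
    absent g y (x ∷ L) (y≢x ∷ ys) rewrite dec-false (x ≟ y) (λ e → y≢x (sym e)) = absent g y L ys
    sift-unique : ∀ (g : A → ℕ) y L → Unique L → y ∈ L → Σ L (λ x → δ x y * g x) ≡ g y
    sift-unique g y (x ∷ L) (x∉L ∷ _) (here refl)
      rewrite dec-true (y ≟ y) refl | absent g y L x∉L = trans (ℕP.+-identityʳ _) (ℕP.+-identityʳ _)
    sift-unique g y (x ∷ L) (x∉L ∷ u) (there y∈L) with x ≟ y
    ... | yes refl = ⊥-elim (All-∈ x∉L y∈L)
      where
      All-∈ : ∀ {M} → All (x ≢_) M → x ∈ M → ⊥
      All-∈ (x≢z ∷ _) (here e) = x≢z e
      All-∈ (_ ∷ zs) (there m) = All-∈ zs m
    ... | no _ = sift-unique g y L u y∈L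

  module _ {L : List A} (enum : Enumerates L) where

    Σ-δ : ∀ y → Σ L (λ x → δ x y) ≡ 1
    Σ-δ y = trans (Σ-cong L (λ x → sym (ℕP.*-identityʳ (δ x y)))) (sift enum (λ _ → 1) y)

    term≤Σ : ∀ (g : A → ℕ) y → g y ≤ Σ L g
    term≤Σ g y = subst (_≤ Σ L g) (sift enum g y) (Σ-mono L (λ x → δ≤1 (does (x ≟ y)) (g x)))
      where
      δ≤1 : ∀ b n → [ b ] * n ≤ n
      δ≤1 true n = ℕP.≤-reflexive (ℕP.*-identityˡ n)
      δ≤1 false n = ℕ.z≤n

    Σ-reindex : (f f⁻¹ : A → A) → (∀ x → f⁻¹ (f x) ≡ x) → (∀ y → f (f⁻¹ y) ≡ y) →
      (g : A → ℕ) → Σ L (λ x → g (f x)) ≡ Σ L g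
    Σ-reindex f f⁻¹ inv₁ inv₂ g = begin
      Σ L (λ x → g (f x))                      ≡⟨ Σ-cong L (λ x → sift enum g (f x)) ⟨
      Σ L (λ x → Σ L (λ y → δ y (f x) * g y))  ≡⟨ Σ-swap L L (λ x y → δ y (f x) * g y) ⟩
      Σ L (λ y → Σ L (λ x → δ y (f x) * g y))  ≡⟨ Σ-cong L (λ y → Σ-*ʳ L (g y) (λ x → δ y (f x))) ⟩
      Σ L (λ y → Σ L (λ x → δ y (f x)) * g y)
        ≡⟨ Σ-cong L (λ y → cong (_* g y) (trans (Σ-cong L (δ-transpose y)) (Σ-δ (f⁻¹ y)))) ⟩
      Σ L (λ y → 1 * g y)                      ≡⟨ Σ-cong L (λ y → ℕP.*-identityˡ (g y)) ⟩
      Σ L g                                    ∎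
      where
      open ≡-Reasoning
      δ-transpose : ∀ y x → δ y (f x) ≡ δ x (f⁻¹ y)
      δ-transpose y x = cong [_] (does-⇔ (mk⇔ (λ { refl → sym (inv₁ x) }) (λ { refl → sym (inv₂ y) }))
                                          (y ≟ f x) (x ≟ f⁻¹ y))

    Σ-split : ∀ (g : A → ℕ) c → Σ L g ≡ g c + Σ L (λ x → [ not (does (x ≟ c)) ] * g x)
    Σ-split g c = trans (Σ-cong L split-term)
      (trans (Σ-+ L _ _) (cong (_+ Σ L (λ x → [ not (does (x ≟ c)) ] * g x)) (sift enum g c)))
      where
      split-term : ∀ x → g x ≡ δ x c * g x + [ not (does (x ≟ c)) ] * g x
      split-term x with x ≟ c
      ... | yes _ = sym (trans (ℕP.+-identityʳ _) (ℕP.*-identityˡ _))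
      ... | no _ = sym (ℕP.*-identityˡ _)

module LinearAlgebra {q : ℕ} (F : FiniteField q) where
  open FiniteField F renaming (_+_ to infixl 6 _⊕_; _*_ to infixl 7 _⊗_; -_ to infix 8 ⊝_)
  open IsCommutativeRing isCommutativeRing
    using (+-assoc; +-identityˡ; +-identityʳ; -‿inverseʳ; -‿inverseˡ;
           *-assoc; *-comm; *-identityˡ; *-identityʳ; distribˡ; zeroˡ; zeroʳ)
  open PG F

  ring : CommutativeRing 0ℓ 0ℓ
  ring = record { isCommutativeRing = isCommutativeRing }

  open import Algebra.Properties.Group (CommutativeRing.+-group ring)
    using (identityˡ-unique; inverseˡ-unique; ⁻¹-involutive)
  open import Algebra.Properties.Ring (CommutativeRing.ring ring) using (-‿distribˡ-*)
  open import Algebra.Properties.CommutativeSemigroup (CommutativeRing.+-commutativeSemigroup ring)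
    using (interchange)
  open ≡-Reasoning

  _⁻¹⟨_⟩ : ∀ c → c ≢ 0# → Carrier
  c ⁻¹⟨ c≢0 ⟩ = proj₁ (inverse c c≢0)

  inverseʳ : ∀ c (c≢0 : c ≢ 0#) → c ⊗ c ⁻¹⟨ c≢0 ⟩ ≡ 1#
  inverseʳ c c≢0 = proj₂ (inverse c c≢0)

  inverseˡ : ∀ c (c≢0 : c ≢ 0#) → c ⁻¹⟨ c≢0 ⟩ ⊗ c ≡ 1#
  inverseˡ c c≢0 = trans (*-comm _ c) (inverseʳ c c≢0)

  no-zero-divisors : ∀ c y → c ≢ 0# → c ⊗ y ≡ 0# → y ≡ 0#
  no-zero-divisors c y c≢0 cy≡0 = begin
    y                       ≡⟨ *-identityˡ y ⟨
    1# ⊗ y                  ≡⟨ cong (_⊗ y) (inverseˡ c c≢0) ⟨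
    c ⁻¹⟨ c≢0 ⟩ ⊗ c ⊗ y     ≡⟨ *-assoc _ c y ⟩
    c ⁻¹⟨ c≢0 ⟩ ⊗ (c ⊗ y)   ≡⟨ cong (c ⁻¹⟨ c≢0 ⟩ ⊗_) cy≡0 ⟩
    c ⁻¹⟨ c≢0 ⟩ ⊗ 0#        ≡⟨ zeroʳ _ ⟩
    0#                      ∎

  𝟎 : ∀ {n} → Vector n
  𝟎 {n} = replicate n 0#

  vneg : ∀ {n} → Vector n → Vector n
  vneg = Data.Vec.map ⊝_

  dot-vadd : ∀ {n} (a x y : Vector n) → dot a (vadd x y) ≡ dot a x ⊕ dot a y
  dot-vadd [] [] [] = sym (+-identityʳ 0#)
  dot-vadd (a ∷ as) (x ∷ xs) (y ∷ ys) = begin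
    a ⊗ (x ⊕ y) ⊕ dot as (vadd xs ys)         ≡⟨ cong₂ _⊕_ (distribˡ a x y) (dot-vadd as xs ys) ⟩
    (a ⊗ x ⊕ a ⊗ y) ⊕ (dot as xs ⊕ dot as ys) ≡⟨ interchange _ _ _ _ ⟩
    (a ⊗ x ⊕ dot as xs) ⊕ (a ⊗ y ⊕ dot as ys) ∎

  dot-scale : ∀ {n} (a : Vector n) c v → dot a (scale c v) ≡ c ⊗ dot a v
  dot-scale [] c [] = sym (zeroʳ c)
  dot-scale (a ∷ as) c (v ∷ vs) = begin
    a ⊗ (c ⊗ v) ⊕ dot as (scale c vs) ≡⟨ cong₂ _⊕_ (left-commute a c v) (dot-scale as c vs) ⟩
    c ⊗ (a ⊗ v) ⊕ c ⊗ dot as vs       ≡⟨ distribˡ c _ _ ⟨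
    c ⊗ (a ⊗ v ⊕ dot as vs)           ∎
    where
    left-commute : ∀ a c v → a ⊗ (c ⊗ v) ≡ c ⊗ (a ⊗ v)
    left-commute a c v = trans (sym (*-assoc a c v)) (trans (cong (_⊗ v) (*-comm a c)) (*-assoc c a v))

  dot-comm : ∀ {n} (a v : Vector n) → dot a v ≡ dot v a
  dot-comm [] [] = refl
  dot-comm (a ∷ as) (v ∷ vs) = cong₂ _⊕_ (*-comm a v) (dot-comm as vs)

  dot-scaleˡ : ∀ {n} c (a v : Vector n) → dot (scale c a) v ≡ c ⊗ dot a v
  dot-scaleˡ c a v = trans (dot-comm (scale c a) v) (trans (dot-scale v c a) (cong (c ⊗_) (dot-comm v a)))

  dot-𝟎 : ∀ {n} (a : Vector n) → dot a 𝟎 ≡ 0#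
  dot-𝟎 [] = refl
  dot-𝟎 (a ∷ as) = trans (cong₂ _⊕_ (zeroʳ a) (dot-𝟎 as)) (+-identityʳ 0#)

  vadd-vneg : ∀ {n} (x w : Vector n) → vadd (vadd x w) (vneg w) ≡ x
  vadd-vneg [] [] = refl
  vadd-vneg (x ∷ xs) (w ∷ ws) =
    cong₂ _∷_ (trans (+-assoc x w (⊝ w)) (trans (cong (x ⊕_) (-‿inverseʳ w)) (+-identityʳ x))) (vadd-vneg xs ws)

  vneg-vadd : ∀ {n} (x w : Vector n) → vadd (vadd x (vneg w)) w ≡ x
  vneg-vadd [] [] = refl
  vneg-vadd (x ∷ xs) (w ∷ ws) =
    cong₂ _∷_ (trans (+-assoc x (⊝ w) w) (trans (cong (x ⊕_) (-‿inverseˡ w)) (+-identityʳ x))) (vneg-vadd xs ws)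

  scale-scale : ∀ {n} c d (v : Vector n) → scale c (scale d v) ≡ scale (c ⊗ d) v
  scale-scale c d [] = refl
  scale-scale c d (v ∷ vs) = cong₂ _∷_ (sym (*-assoc c d v)) (scale-scale c d vs)

  scale-1 : ∀ {n} (v : Vector n) → scale 1# v ≡ v
  scale-1 [] = refl
  scale-1 (v ∷ vs) = cong₂ _∷_ (*-identityˡ v) (scale-1 vs)

  scale-inverse : ∀ {n} c (c≢0 : c ≢ 0#) (v : Vector n) → scale (c ⁻¹⟨ c≢0 ⟩) (scale c v) ≡ v
  scale-inverse c c≢0 v = trans (scale-scale _ c v) (trans (cong (λ z → scale z v) (inverseˡ c c≢0)) (scale-1 v))

  scale-inverse′ : ∀ {n} c (c≢0 : c ≢ 0#) (v : Vector n) → scale c (scale (c ⁻¹⟨ c≢0 ⟩) v) ≡ v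
  scale-inverse′ c c≢0 v = trans (scale-scale c _ v) (trans (cong (λ z → scale z v) (inverseʳ c c≢0)) (scale-1 v))

  scale-0# : ∀ {n} (v : Vector n) → scale 0# v ≡ 𝟎
  scale-0# [] = refl
  scale-0# (v ∷ vs) = cong₂ _∷_ (zeroˡ v) (scale-0# vs)

  scale-𝟎 : ∀ {n} c → scale c (𝟎 {n}) ≡ 𝟎
  scale-𝟎 {zero} c = refl
  scale-𝟎 {suc n} c = cong₂ _∷_ (zeroʳ c) (scale-𝟎 c)

  zero-or-onto : ∀ {n} (a : Vector n) → (a ≡ 𝟎) ⊎ (∃ λ u → dot a u ≡ 1#)
  zero-or-onto [] = inj₁ refl
  zero-or-onto (x ∷ a) with x ≟ 0#
  ... | no x≢0 =
    inj₂ (x ⁻¹⟨ x≢0 ⟩ ∷ 𝟎 , trans (cong₂ _⊕_ (inverseʳ x x≢0) (dot-𝟎 a)) (+-identityʳ 1#))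
  ... | yes refl with zero-or-onto a
  ...   | inj₁ a≡0 = inj₁ (cong (0# ∷_) a≡0)
  ...   | inj₂ (u , au≡1) = inj₂ (0# ∷ u , trans (cong₂ _⊕_ (zeroˡ 0#) au≡1) (+-identityˡ 1#))

  ≟-shift : ∀ y c → does ((y ⊕ c) ≟ c) ≡ does (y ≟ 0#)
  ≟-shift y c = does-⇔ (mk⇔ (identityˡ-unique y c) (λ { refl → +-identityˡ c })) ((y ⊕ c) ≟ c) (y ≟ 0#)

  ≟-scale : ∀ c y → c ≢ 0# → does ((c ⊗ y) ≟ 0#) ≡ does (y ≟ 0#)
  ≟-scale c y c≢0 = does-⇔ (mk⇔ (no-zero-divisors c y c≢0) (λ { refl → zeroʳ c })) ((c ⊗ y) ≟ 0#) (y ≟ 0#)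

  solve-for : ∀ y x c → y ⊕ (⊝ x) ⊗ c ≡ 0# → y ≡ c ⊗ x
  solve-for y x c e = begin
    y                 ≡⟨ inverseˡ-unique y _ e ⟩
    ⊝ ((⊝ x) ⊗ c)     ≡⟨ cong ⊝_ (-‿distribˡ-* x c) ⟨
    ⊝ (⊝ (x ⊗ c))     ≡⟨ ⁻¹-involutive (x ⊗ c) ⟩
    x ⊗ c             ≡⟨ *-comm x c ⟩
    c ⊗ x             ∎

  proportional-or-separated : ∀ {n} (a b : Vector n) →
    (∃ λ c → b ≡ scale c a) ⊎ (∃ λ v → dot a v ≡ 0# × dot b v ≢ 0#)
  proportional-or-separated [] [] = inj₁ (0# , refl)
  proportional-or-separated (x ∷ a) (y ∷ b) with proportional-or-separated a b
  ... | inj₂ (v , av≡0 , bv≢0) = inj₂ (0# ∷ v , extend-a , extend-b)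
    where
    extend-a : x ⊗ 0# ⊕ dot a v ≡ 0#
    extend-a = trans (cong₂ _⊕_ (zeroʳ x) av≡0) (+-identityʳ 0#)
    extend-b : y ⊗ 0# ⊕ dot b v ≢ 0#
    extend-b e = bv≢0 (trans (sym (+-identityˡ _)) (trans (cong (_⊕ dot b v) (sym (zeroʳ y))) e))
  ... | inj₁ (c , b≡ca) with y ≟ (c ⊗ x)
  ...   | yes y≡cx = inj₁ (c , cong₂ _∷_ y≡cx b≡ca)
  ...   | no y≢cx with zero-or-onto a
  ...     | inj₂ (u , au≡1) = inj₂ (1# ∷ scale (⊝ x) u , kernel-a , outside-b)
    where
    -- v = (1, -x u) kills (x, a) but not (y, c a)
    b-value : dot b (scale (⊝ x) u) ≡ (⊝ x) ⊗ c
    b-value = begin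
      dot b (scale (⊝ x) u)          ≡⟨ dot-scale b (⊝ x) u ⟩
      (⊝ x) ⊗ dot b u                ≡⟨ cong (λ z → (⊝ x) ⊗ dot z u) b≡ca ⟩
      (⊝ x) ⊗ dot (scale c a) u      ≡⟨ cong ((⊝ x) ⊗_) (trans (dot-scaleˡ c a u) (cong (c ⊗_) au≡1)) ⟩
      (⊝ x) ⊗ (c ⊗ 1#)               ≡⟨ cong ((⊝ x) ⊗_) (*-identityʳ c) ⟩
      (⊝ x) ⊗ c                      ∎
    kernel-a : x ⊗ 1# ⊕ dot a (scale (⊝ x) u) ≡ 0#
    kernel-a = begin
      x ⊗ 1# ⊕ dot a (scale (⊝ x) u) ≡⟨ cong₂ _⊕_ (*-identityʳ x) (dot-scale a (⊝ x) u) ⟩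
      x ⊕ (⊝ x) ⊗ dot a u            ≡⟨ cong (λ z → x ⊕ (⊝ x) ⊗ z) au≡1 ⟩
      x ⊕ (⊝ x) ⊗ 1#                 ≡⟨ cong (x ⊕_) (*-identityʳ (⊝ x)) ⟩
      x ⊕ ⊝ x                        ≡⟨ -‿inverseʳ x ⟩
      0#                             ∎
    outside-b : y ⊗ 1# ⊕ dot b (scale (⊝ x) u) ≢ 0#
    outside-b e = y≢cx (solve-for y x c (trans (cong₂ _⊕_ (sym (*-identityʳ y)) (sym b-value)) e))
  ...     | inj₁ a≡0 with x ≟ 0#
  ...       | yes refl = inj₂ (1# ∷ 𝟎 , kernel-a , outside-b)
    where
    -- x = 0 and a = 0: v = (1, 0) kills (0, a) but not (y, b), as y ≠ c 0 = 0
    kernel-a : 0# ⊗ 1# ⊕ dot a 𝟎 ≡ 0#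
    kernel-a = trans (cong₂ _⊕_ (zeroˡ 1#) (dot-𝟎 a)) (+-identityʳ 0#)
    outside-b : y ⊗ 1# ⊕ dot b 𝟎 ≢ 0#
    outside-b e = y≢cx (trans (sym (*-identityʳ y)) (trans (sym (+-identityʳ _))
                    (trans (cong (y ⊗ 1# ⊕_) (sym (dot-𝟎 b))) (trans e (sym (zeroʳ c))))))
  ...       | no x≢0 = inj₁ (y ⊗ x ⁻¹⟨ x≢0 ⟩ , cong₂ _∷_ y-coord b-zero)
    where
    -- x ≠ 0 and a = 0 = b: then (y, b) = (y / x) (x, a)
    y-coord : y ≡ y ⊗ x ⁻¹⟨ x≢0 ⟩ ⊗ x
    y-coord = sym (trans (*-assoc y _ x) (trans (cong (y ⊗_) (inverseˡ x x≢0)) (*-identityʳ y)))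
    b-zero : b ≡ scale (y ⊗ x ⁻¹⟨ x≢0 ⟩) a
    b-zero = begin
      b                              ≡⟨ b≡ca ⟩
      scale c a                      ≡⟨ cong (scale c) a≡0 ⟩
      scale c 𝟎                      ≡⟨ scale-𝟎 c ⟩
      𝟎                              ≡⟨ scale-𝟎 _ ⟨
      scale (y ⊗ x ⁻¹⟨ x≢0 ⟩) 𝟎      ≡⟨ cong (scale _) a≡0 ⟨
      scale (y ⊗ x ⁻¹⟨ x≢0 ⟩) a      ∎

  ≟-sound : ∀ {x y} → does (x ≟ y) ≡ true → x ≡ y
  ≟-sound {x} {y} e with x ≟ y
  ... | yes x≡y = x≡y
  ... | no _ with () ← e

  normalized-0∷ : ∀ {n} (v : Vector n) → normalized (0# ∷ v) ≡ normalized v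
  normalized-0∷ v with 0# ≟ 0#
  ... | yes _ = refl
  ... | no 0≢0 = ⊥-elim (0≢0 refl)

  normalized-≢0∷ : ∀ {n} y (v : Vector n) → y ≢ 0# → normalized (y ∷ v) ≡ does (y ≟ 1#)
  normalized-≢0∷ y v y≢0 with y ≟ 0#
  ... | yes y≡0 = ⊥-elim (y≢0 y≡0)
  ... | no _ = refl

  normalized-𝟎 : ∀ n → normalized (𝟎 {n}) ≡ false
  normalized-𝟎 zero = refl
  normalized-𝟎 (suc n) = trans (normalized-0∷ (𝟎 {n})) (normalized-𝟎 n)

  -- A normalized vector is nonzero, so as a linear form it takes the value 1.
  normalized-onto : ∀ {n} (a : Vector n) → normalized a ≡ true → ∃ λ u → dot a u ≡ 1#
  normalized-onto {n} a na with zero-or-onto a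
  ... | inj₂ onto = onto
  ... | inj₁ refl with () ← trans (sym (normalized-𝟎 n)) na

  normalized-unique : ∀ {n} (a : Vector n) c → normalized a ≡ true → normalized (scale c a) ≡ true →
    scale c a ≡ a
  normalized-unique (x ∷ a) c na nca with x ≟ 0#
  ... | yes refl = cong₂ _∷_ (zeroʳ c) (normalized-unique a c na nca-tail)
    where
    nca-tail : normalized (scale c a) ≡ true
    nca-tail = trans (sym (normalized-0∷ (scale c a)))
                 (subst (λ z → normalized (z ∷ scale c a) ≡ true) (zeroʳ c) nca)
  ... | no x≢0 with refl ← ≟-sound na with c ≟ 0#
  ...   | yes refl with () ← trans (sym (trans (cong normalized (scale-0# (1# ∷ a))) (normalized-𝟎 _))) nca
  ...   | no c≢0 = trans (cong (λ z → scale z (1# ∷ a)) c≡1) (scale-1 (1# ∷ a))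
    where
    c1≢0 : c ⊗ 1# ≢ 0#
    c1≢0 e = x≢0 (no-zero-divisors c 1# c≢0 e)
    c≡1 : c ≡ 1#
    c≡1 = trans (sym (*-identityʳ c)) (≟-sound (trans (sym (normalized-≢0∷ (c ⊗ 1#) (scale c a) c1≢0)) nca))

module Counting {q : ℕ} (F : FiniteField q) where
  open FiniteField F renaming (_+_ to infixl 6 _⊕_; _*_ to infixl 7 _⊗_; -_ to infix 8 ⊝_)
  open IsCommutativeRing isCommutativeRing using (+-identityʳ; *-identityʳ; zeroʳ)
  open PG F
  open LinearAlgebra F
  module Scalars = Enumeration _≟_
  module Vectors (n : ℕ) = Enumeration (≡-dec {n = n} _≟_)
  open ≡-Reasoning

  elements-enumerate : Scalars.Enumerates elements
  elements-enumerate = Scalars.unique-complete-enumerates elements unique complete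

  Σ-allVecs-suc : ∀ n (f : Vector (suc n) → ℕ) →
    Σ (allVecs (suc n)) f ≡ Σ elements (λ x → Σ (allVecs n) (λ xs → f (x ∷ xs)))
  Σ-allVecs-suc n f = trans (Σ-concatMap elements (λ x → map (x ∷_) (allVecs n)) f)
                            (Σ-cong elements (λ x → Σ-map (allVecs n) (x ∷_) f))

  allVecs-enumerate : ∀ n → Vectors.Enumerates n (allVecs n)
  allVecs-enumerate n = Vectors.enumerates (sift-allVecs n)
    where
    sift-allVecs : ∀ n (g : Vector n → ℕ) y → Σ (allVecs n) (λ x → Vectors.δ n x y * g x) ≡ g y
    sift-allVecs zero g [] = trans (ℕP.+-identityʳ _) (ℕP.+-identityʳ _)
    sift-allVecs (suc n) g (y ∷ ys) = begin
      Σ (allVecs (suc n)) (λ v → Vectors.δ (suc n) v (y ∷ ys) * g v)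
        ≡⟨ Σ-allVecs-suc n _ ⟩
      Σ elements (λ x → Σ (allVecs n) (λ xs → Vectors.δ (suc n) (x ∷ xs) (y ∷ ys) * g (x ∷ xs)))
        ≡⟨ Σ-cong elements (λ x → Σ-cong (allVecs n) (λ xs →
             trans (cong (_* g (x ∷ xs)) (δ-∷ x y xs ys)) (ℕP.*-assoc (Scalars.δ x y) _ _))) ⟩
      Σ elements (λ x → Σ (allVecs n) (λ xs → Scalars.δ x y * (Vectors.δ n xs ys * g (x ∷ xs))))
        ≡⟨ Σ-cong elements (λ x → trans (Σ-*ˡ (allVecs n) (Scalars.δ x y) _)
             (cong (Scalars.δ x y *_) (sift-allVecs n (λ xs → g (x ∷ xs)) ys))) ⟩
      Σ elements (λ x → Scalars.δ x y * g (x ∷ ys))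
        ≡⟨ Scalars.sift elements-enumerate (λ x → g (x ∷ ys)) y ⟩
      g (y ∷ ys) ∎
      where
      δ-∷ : ∀ x y (xs ys : Vector n) →
        Vectors.δ (suc n) (x ∷ xs) (y ∷ ys) ≡ Scalars.δ x y * Vectors.δ n xs ys
      δ-∷ x y xs ys with x ≟ y | ≡-dec _≟_ xs ys
      ... | yes _ | yes _ = refl
      ... | yes _ | no _ = refl
      ... | no _ | _ = refl

  Σ-elements-const : ∀ k → Σ elements (λ _ → k) ≡ q * k
  Σ-elements-const k = trans (Σ-const elements k) (cong (_* k) size)

  Σ-allVecs-1 : ∀ n → Σ (allVecs n) (λ _ → 1) ≡ q ^ n
  Σ-allVecs-1 zero = refl
  Σ-allVecs-1 (suc n) = begin
    Σ (allVecs (suc n)) (λ _ → 1)           ≡⟨ Σ-allVecs-suc n _ ⟩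
    Σ elements (λ _ → Σ (allVecs n) (λ _ → 1)) ≡⟨ Σ-cong elements (λ _ → Σ-allVecs-1 n) ⟩
    Σ elements (λ _ → q ^ n)                ≡⟨ Σ-elements-const (q ^ n) ⟩
    q ^ suc n                               ∎

  Σ-translate : ∀ n (w : Vector n) (g : Vector n → ℕ) →
    Σ (allVecs n) (λ x → g (vadd x w)) ≡ Σ (allVecs n) g
  Σ-translate n w = Vectors.Σ-reindex n (allVecs-enumerate n) (λ x → vadd x w) (λ x → vadd x (vneg w))
                      (λ x → vadd-vneg x w) (λ x → vneg-vadd x w)

  Σ-scale : ∀ n c → c ≢ 0# → (g : Vector n → ℕ) → Σ (allVecs n) (λ x → g (scale c x)) ≡ Σ (allVecs n) g
  Σ-scale n c c≢0 = Vectors.Σ-reindex n (allVecs-enumerate n) (scale c) (scale (c ⁻¹⟨ c≢0 ⟩))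
                      (scale-inverse c c≢0) (scale-inverse′ c c≢0)

  Σ-elements-≟ : ∀ y → Σ elements (λ d → [ does (y ≟ d) ]) ≡ 1
  Σ-elements-≟ y = trans (Σ-cong elements (λ d → Scalars.δ-sym y d)) (Scalars.Σ-δ elements-enumerate y)

  -- K = q - 1, the number of nonzero scalars.
  K : ℕ
  K = Σ elements (λ c → [ not (does (c ≟ 0#)) ])

  q≡1+K : q ≡ suc K
  q≡1+K = begin
    q                       ≡⟨ trans (sym (ℕP.*-identityʳ q)) (sym (Σ-elements-const 1)) ⟩
    Σ elements (λ _ → 1)    ≡⟨ Scalars.Σ-split elements-enumerate (λ _ → 1) 0# ⟩
    suc (Σ elements (λ c → [ not (does (c ≟ 0#)) ] * 1))
                            ≡⟨ cong suc (Σ-cong elements (λ c → ℕP.*-identityʳ _)) ⟩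
    suc K                   ∎

  -- K ≥ 1 because 1 ≠ 0 in a field.
  instance
    K-nonzero : NonZero K
    K-nonzero = ℕ.>-nonZero (subst (_≤ K) one (Scalars.term≤Σ elements-enumerate _ 1#))
      where
      one : [ not (does (1# ≟ 0#)) ] ≡ 1
      one = cong (λ b → [ not b ]) (dec-false (1# ≟ 0#) (λ e → 0≢1 (sym e)))

  q-nonzero : NonZero q
  q-nonzero = subst NonZero (sym q≡1+K) _

  -- Slicing by a linear form: if b takes the value 1 on v and the predicate P is
  -- invariant under translation along v, then the hyperplane b = 0 contains exactly
  -- a q-th part of P (the level sets b = d are translates of each other).
  slice : ∀ n (P : Vector n → Bool) (b v : Vector n) → dot b v ≡ 1# →
    (∀ x d → P (vadd x (scale d v)) ≡ P x) →
    q * Σ (allVecs n) (λ x → [ P x ] * [ incident b x ]) ≡ Σ (allVecs n) (λ x → [ P x ])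
  slice n P b v bv≡1 P-inv = begin
    q * level 0#              ≡⟨ Σ-elements-const (level 0#) ⟨
    Σ elements (λ _ → level 0#) ≡⟨ Σ-cong elements level-constant ⟨
    Σ elements level          ≡⟨ Σ-swap elements (allVecs n) (λ d x → [ P x ] * [ does (dot b x ≟ d) ]) ⟩
    Σ (allVecs n) (λ x → Σ elements (λ d → [ P x ] * [ does (dot b x ≟ d) ]))
      ≡⟨ Σ-cong (allVecs n) (λ x → trans (Σ-*ˡ elements [ P x ] _)
           (trans (cong ([ P x ] *_) (Σ-elements-≟ (dot b x))) (ℕP.*-identityʳ _))) ⟩
    Σ (allVecs n) (λ x → [ P x ]) ∎
    where
    level : Carrier → ℕ
    level d = Σ (allVecs n) (λ x → [ P x ] * [ does (dot b x ≟ d) ])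
    b-shift : ∀ x d → dot b (vadd x (scale d v)) ≡ dot b x ⊕ d
    b-shift x d = trans (dot-vadd b x (scale d v))
                    (cong (dot b x ⊕_) (trans (dot-scale b d v) (trans (cong (d ⊗_) bv≡1) (*-identityʳ d))))
    level-constant : ∀ d → level d ≡ level 0#
    level-constant d = trans (sym (Σ-translate n (scale d v) _))
      (Σ-cong (allVecs n) (λ x → cong₂ _*_ (cong [_] (P-inv x d))
        (cong [_] (trans (cong (λ z → does (z ≟ d)) (b-shift x d)) (≟-shift (dot b x) d)))))

  hyperplane-size : ∀ m (a u : Vector (suc m)) → dot a u ≡ 1# →
    Σ (allVecs (suc m)) (λ x → [ incident a x ]) ≡ q ^ m
  hyperplane-size m a u au≡1 = ℕP.*-cancelˡ-≡ _ _ q ⦃ q-nonzero ⦄ (begin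
    q * Σ (allVecs (suc m)) (λ x → [ incident a x ])
      ≡⟨ cong (q *_) (Σ-cong (allVecs (suc m)) (λ x → ℕP.+-identityʳ _)) ⟨
    q * Σ (allVecs (suc m)) (λ x → 1 * [ incident a x ])
      ≡⟨ slice (suc m) (λ _ → true) a u au≡1 (λ _ _ → refl) ⟩
    Σ (allVecs (suc m)) (λ _ → 1)                        ≡⟨ Σ-allVecs-1 (suc m) ⟩
    q * q ^ m                                            ∎)

  hyperplane-pair-size : ∀ m (a b u v : Vector (suc (suc m))) →
    dot a u ≡ 1# → dot a v ≡ 0# → dot b v ≡ 1# →
    Σ (allVecs (suc (suc m))) (λ x → [ incident a x ] * [ incident b x ]) ≡ q ^ m
  hyperplane-pair-size m a b u v au≡1 av≡0 bv≡1 = ℕP.*-cancelˡ-≡ _ _ q ⦃ q-nonzero ⦄ (begin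
    q * Σ (allVecs (suc (suc m))) (λ x → [ incident a x ] * [ incident b x ])
      ≡⟨ slice (suc (suc m)) (incident a) b v bv≡1 a-invariant ⟩
    Σ (allVecs (suc (suc m))) (λ x → [ incident a x ])
      ≡⟨ hyperplane-size (suc m) a u au≡1 ⟩
    q * q ^ m ∎)
    where
    a-invariant : ∀ x d → incident a (vadd x (scale d v)) ≡ incident a x
    a-invariant x d = cong (λ z → does (z ≟ 0#))
      (trans (dot-vadd a x (scale d v))
        (trans (cong (dot a x ⊕_) (trans (dot-scale a d v) (trans (cong (d ⊗_) av≡0) (zeroʳ d)))) (+-identityʳ _)))

  Cone : ∀ {n} → (Vector n → Bool) → Set
  Cone P = ∀ c x → c ≢ 0# → P (scale c x) ≡ P x

  -- A cone containing 0 consists of 0 and the K nonzero multiples of each of its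
  -- normalized vectors; this is how points of PG(n-1,q) are counted.
  cone-size : ∀ n (P : Vector n → Bool) → P 𝟎 ≡ true → Cone P →
    Σ (allVecs n) (λ x → [ P x ]) ≡ suc (K * Σ (allVecs n) (λ x → [ normalized x ∧ P x ]))
  cone-size zero P P0 cone rewrite P0 = cong suc (sym (ℕP.*-zeroʳ K))
  cone-size (suc n) P P0 cone = begin
    Σ (allVecs (suc n)) (λ x → [ P x ])  ≡⟨ Σ-allVecs-suc n _ ⟩
    Σ elements section                   ≡⟨ Scalars.Σ-split elements-enumerate section 0# ⟩
    section 0# + Σ elements (λ c → [ not (does (c ≟ 0#)) ] * section c)
      ≡⟨ cong (section 0# +_) (trans (Σ-cong elements nonzero-sections) (Σ-*ʳ elements (section 1#) _)) ⟩
    section 0# + K * section 1#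
      ≡⟨ cong (_+ K * section 1#) (cone-size n (λ xs → P (0# ∷ xs)) P0 tail-cone) ⟩
    suc (K * N₀ + K * section 1#)        ≡⟨ cong suc (ℕP.*-distribˡ-+ K N₀ (section 1#)) ⟨
    suc (K * (N₀ + section 1#))          ≡⟨ cong (λ z → suc (K * z)) normalized-split ⟨
    suc (K * Σ (allVecs (suc n)) (λ x → [ normalized x ∧ P x ])) ∎
    where
    section : Carrier → ℕ
    section c = Σ (allVecs n) (λ xs → [ P (c ∷ xs) ])
    N₀ : ℕ
    N₀ = Σ (allVecs n) (λ xs → [ normalized xs ∧ P (0# ∷ xs) ])

    tail-cone : Cone (λ xs → P (0# ∷ xs))
    tail-cone c x c≢0 = trans (cong (λ z → P (z ∷ scale c x)) (sym (zeroʳ c))) (cone c (0# ∷ x) c≢0)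

    -- scaling by c maps the section at 1 bijectively onto the section at c
    section-constant : ∀ c → c ≢ 0# → section c ≡ section 1#
    section-constant c c≢0 = trans (sym (Σ-scale n c c≢0 (λ xs → [ P (c ∷ xs) ])))
      (Σ-cong (allVecs n) (λ xs → cong [_]
        (trans (cong (λ z → P (z ∷ scale c xs)) (sym (*-identityʳ c))) (cone c (1# ∷ xs) c≢0))))

    nonzero-sections : ∀ c → [ not (does (c ≟ 0#)) ] * section c ≡ [ not (does (c ≟ 0#)) ] * section 1#
    nonzero-sections c with c ≟ 0#
    ... | yes _ = refl
    ... | no c≢0 = cong (1 *_) (section-constant c c≢0)

    normalized-head : ∀ c xs → [ normalized (c ∷ xs) ∧ P (c ∷ xs) ]
      ≡ Scalars.δ c 0# * [ normalized xs ∧ P (0# ∷ xs) ] + Scalars.δ c 1# * [ P (1# ∷ xs) ]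
    normalized-head c xs with c ≟ 0#
    ... | yes refl rewrite dec-false (0# ≟ 1#) 0≢1 = sym (trans (ℕP.+-identityʳ _) (ℕP.+-identityʳ _))
    ... | no _ with c ≟ 1#
    ...   | yes refl = sym (ℕP.+-identityʳ _)
    ...   | no _ = refl

    normalized-split : Σ (allVecs (suc n)) (λ x → [ normalized x ∧ P x ]) ≡ N₀ + section 1#
    normalized-split = begin
      Σ (allVecs (suc n)) (λ x → [ normalized x ∧ P x ])  ≡⟨ Σ-allVecs-suc n _ ⟩
      Σ elements (λ c → Σ (allVecs n) (λ xs → [ normalized (c ∷ xs) ∧ P (c ∷ xs) ]))
        ≡⟨ Σ-cong elements (λ c → trans (Σ-cong (allVecs n) (normalized-head c))
             (trans (Σ-+ (allVecs n) _ _)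
               (cong₂ _+_ (Σ-*ˡ (allVecs n) (Scalars.δ c 0#) _) (Σ-*ˡ (allVecs n) (Scalars.δ c 1#) _)))) ⟩
      Σ elements (λ c → Scalars.δ c 0# * N₀ + Scalars.δ c 1# * section 1#)
        ≡⟨ Σ-+ elements _ _ ⟩
      Σ elements (λ c → Scalars.δ c 0# * N₀) + Σ elements (λ c → Scalars.δ c 1# * section 1#)
        ≡⟨ cong₂ _+_ (Scalars.sift elements-enumerate (λ _ → N₀) 0#)
                     (Scalars.sift elements-enumerate (λ _ → section 1#) 1#) ⟩
      N₀ + section 1# ∎

  -- θ m = q^m + ... + q + 1, the number of points of PG(m,q).
  θ : ℕ → ℕ
  θ zero = 1
  θ (suc m) = q ^ suc m + θ m

  q^1+m≡1+Kθ : ∀ m → q ^ suc m ≡ suc (K * θ m)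
  q^1+m≡1+Kθ zero = trans (ℕP.*-identityʳ q) (trans q≡1+K (cong suc (sym (ℕP.*-identityʳ K))))
  q^1+m≡1+Kθ (suc m) = begin
    q * q ^ suc m                    ≡⟨ cong₂ _*_ q≡1+K (q^1+m≡1+Kθ m) ⟩
    suc K * suc (K * θ m)            ≡⟨ geometric K (θ m) ⟩
    suc (K * (suc (K * θ m) + θ m))  ≡⟨ cong (λ z → suc (K * (z + θ m))) (q^1+m≡1+Kθ m) ⟨
    suc (K * θ (suc m))              ∎
    where
    open import Data.Nat.Solver using (module +-*-Solver)
    open +-*-Solver
    geometric : ∀ k t → suc k * suc (k * t) ≡ suc (k * (suc (k * t) + t))
    geometric = solve 2 (λ k t → (con 1 :+ k) :* (con 1 :+ k :* t)
                                 := con 1 :+ k :* ((con 1 :+ k :* t) :+ t)) refl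

  normalized-count : ∀ n m (P : Vector n → Bool) → P 𝟎 ≡ true → Cone P →
    Σ (allVecs n) (λ x → [ P x ]) ≡ q ^ suc m →
    Σ (allVecs n) (λ x → [ normalized x ∧ P x ]) ≡ θ m
  normalized-count n m P P0 cone size = ℕP.*-cancelˡ-≡ _ _ K
    (ℕP.suc-injective (trans (sym (cone-size n P P0 cone)) (trans size (q^1+m≡1+Kθ m))))

  incident-𝟎 : ∀ {n} (a : Vector n) → incident a 𝟎 ≡ true
  incident-𝟎 a = trans (cong (λ z → does (z ≟ 0#)) (dot-𝟎 a)) (dec-true (0# ≟ 0#) refl)

  incident-cone : ∀ {n} (a : Vector n) → Cone (incident a)
  incident-cone a c x c≢0 = trans (cong (λ z → does (z ≟ 0#)) (dot-scale a c x)) (≟-scale c (dot a x) c≢0)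

  points-on-hyperplane : ∀ m (a : Vector (suc (suc m))) → normalized a ≡ true →
    Σ (allVecs (suc (suc m))) (λ x → [ normalized x ∧ incident a x ]) ≡ θ m
  points-on-hyperplane m a na =
    normalized-count (suc (suc m)) m (incident a) (incident-𝟎 a) (incident-cone a)
      (hyperplane-size (suc m) a (proj₁ (normalized-onto a na)) (proj₂ (normalized-onto a na)))

  points-on-two-hyperplanes : ∀ m (a b : Vector (suc (suc (suc m)))) →
    normalized a ≡ true → normalized b ≡ true → a ≢ b →
    Σ (allVecs (suc (suc (suc m)))) (λ x → [ normalized x ∧ (incident a x ∧ incident b x) ]) ≡ θ m
  points-on-two-hyperplanes m a b na nb a≢b with proportional-or-separated a b
  ... | inj₁ (c , refl) = ⊥-elim (a≢b (sym (normalized-unique a c na nb)))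
  ... | inj₂ (v , av≡0 , bv≢0) =
    normalized-count (suc (suc (suc m))) m (λ x → incident a x ∧ incident b x)
      (cong₂ _∧_ (incident-𝟎 a) (incident-𝟎 b))
      (λ c x c≢0 → cong₂ _∧_ (incident-cone a c x c≢0) (incident-cone b c x c≢0))
      (trans (Σ-cong (allVecs _) (λ x → [∧] (incident a x) (incident b x)))
        (hyperplane-pair-size (suc m) a b (proj₁ (normalized-onto a na)) v′
          (proj₂ (normalized-onto a na)) av′≡0 bv′≡1))
    where
    v′ : Vector (suc (suc (suc m)))
    v′ = scale (dot b v ⁻¹⟨ bv≢0 ⟩) v
    av′≡0 : dot a v′ ≡ 0#
    av′≡0 = trans (dot-scale a _ v) (trans (cong (_ ⊗_) av≡0) (zeroʳ _))
    bv′≡1 : dot b v′ ≡ 1#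
    bv′≡1 = trans (dot-scale b _ v) (inverseˡ _ bv≢0)

-- A number n known to be one of two values W and B = W - G (G ≠ 0) is determined by
-- the test n = B: n + G [n = B] = W.  This turns the two point types into one linear identity.
two-values : ∀ {n W B G} → B + G ≡ W → G ≢ 0 → n ≡ W ⊎ n ≡ B → n + G * [ does (n ℕ.≟ B) ] ≡ W
two-values {W = W} {B} {G} B+G≡W G≢0 (inj₁ refl) = begin
  W + G * [ does (W ℕ.≟ B) ]  ≡⟨ cong (λ b → W + G * [ b ]) (dec-false (W ℕ.≟ B) W≢B) ⟩
  W + G * 0                   ≡⟨ cong (W +_) (ℕP.*-zeroʳ G) ⟩
  W + 0                       ≡⟨ ℕP.+-identityʳ W ⟩
  W                           ∎
  where
  open ≡-Reasoning
  W≢B : W ≢ B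
  W≢B W≡B = G≢0 (ℕP.+-cancelˡ-≡ B G 0 (trans B+G≡W (trans W≡B (sym (ℕP.+-identityʳ B)))))
two-values {B = B} {G} B+G≡W G≢0 (inj₂ refl) =
  trans (cong (λ b → B + G * [ b ]) (dec-true (B ℕ.≟ B) refl)) (trans (cong (B +_) (ℕP.*-identityʳ G)) B+G≡W)

-- The values for even q = 2h (h ≥ 1): a white point lies in W = q³/2 solids and a black
-- point in B = (q³ - q²)/2 = W - G solids, where G = q²/2 = 2h².
module EvenOrder (h : ℕ) ⦃ _ : NonZero h ⦄ where
  open import Data.Nat.Solver using (module +-*-Solver)
  open +-*-Solver

  q W B G : ℕ
  q = h * 2
  W = q ^ 3 ℕ./ 2
  B = (q ^ 3 ℕ.∸ q ^ 2) ℕ./ 2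
  G = h * h * 2

  q²≡G*2 : q ^ 2 ≡ G * 2
  q²≡G*2 = solve 1 (λ h → (h :* con 2) :^ 2 := h :* h :* con 2 :* con 2) refl h

  q³≡Gq*2 : q ^ 3 ≡ G * q * 2
  q³≡Gq*2 = solve 1 (λ h → (h :* con 2) :^ 3 := h :* h :* con 2 :* (h :* con 2) :* con 2) refl h

  G-nonzero : G ≢ 0
  G-nonzero = ℕ.≢-nonZero⁻¹ G ⦃ ℕP.m*n≢0 (h * h) 2 ⦃ ℕP.m*n≢0 h h ⦄ ⦄

  W≡Gq : W ≡ G * q
  W≡Gq = trans (cong (ℕ._/ 2) q³≡Gq*2) (ℕD.m*n/n≡m (G * q) 2)

  B+G≡W : B + G ≡ W
  B+G≡W = begin
    (q ^ 3 ℕ.∸ q ^ 2) ℕ./ 2 + G       ≡⟨ cong (λ t → t ℕ./ 2 + G) (cong₂ ℕ._∸_ q³≡Gq*2 q²≡G*2) ⟩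
    (G * q * 2 ℕ.∸ G * 2) ℕ./ 2 + G   ≡⟨ cong (λ t → t ℕ./ 2 + G) (ℕP.*-distribʳ-∸ 2 (G * q) G) ⟨
    (G * q ℕ.∸ G) * 2 ℕ./ 2 + G       ≡⟨ cong (_+ G) (ℕD.m*n/n≡m (G * q ℕ.∸ G) 2) ⟩
    G * q ℕ.∸ G + G                   ≡⟨ ℕP.m∸n+n≡m (ℕP.m≤m*n G q ⦃ ℕP.m*n≢0 h 2 ⦄) ⟩
    G * q                             ≡⟨ W≡Gq ⟨
    W                                 ∎
    where open ≡-Reasoning

  2W≡q³ : 2 * W ≡ q ^ 3
  2W≡q³ = trans (cong (2 *_) W≡Gq) (trans (ℕP.*-comm 2 (G * q)) (sym q³≡Gq*2))

  2G≡q² : 2 * G ≡ q ^ 2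
  2G≡q² = trans (ℕP.*-comm 2 G) (sym q²≡G*2)

-- The double-counting identity e θ₂ + q³ + G s = W θ₃ (with 2W = q³, 2G = q²) is
-- equivalent to the claimed (s + q) q² = (q⁴ - 2e) θ₂, here in cancellation-free form.
rearrange : ∀ q s e W G → 2 * W ≡ q ^ 3 → 2 * G ≡ q ^ 2 →
  e * (q ^ 2 + (q ^ 1 + 1)) + q ^ 3 + G * s ≡ W * (q ^ 3 + (q ^ 2 + (q ^ 1 + 1))) →
  (s + q) * q ^ 2 + 2 * e * (q ^ 2 + q + 1) ≡ q ^ 4 * (q ^ 2 + q + 1)
rearrange q s e W G 2W≡q³ 2G≡q² count = ℕP.+-cancelʳ-≡ (q ^ 3) _ _ (begin
  (s + q) * q ^ 2 + 2 * e * (q ^ 2 + q + 1) + q ^ 3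
    ≡⟨ expand q s e ⟩
  q ^ 2 * s + 2 * (e * (q ^ 2 + (q ^ 1 + 1)) + q ^ 3)
    ≡⟨ cong (λ t → t * s + 2 * (e * (q ^ 2 + (q ^ 1 + 1)) + q ^ 3)) 2G≡q² ⟨
  2 * G * s + 2 * (e * (q ^ 2 + (q ^ 1 + 1)) + q ^ 3)
    ≡⟨ collect G s (e * (q ^ 2 + (q ^ 1 + 1)) + q ^ 3) ⟩
  2 * (e * (q ^ 2 + (q ^ 1 + 1)) + q ^ 3 + G * s)
    ≡⟨ cong (2 *_) count ⟩
  2 * (W * (q ^ 3 + (q ^ 2 + (q ^ 1 + 1))))
    ≡⟨ ℕP.*-assoc 2 W _ ⟨
  2 * W * (q ^ 3 + (q ^ 2 + (q ^ 1 + 1)))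
    ≡⟨ cong (_* (q ^ 3 + (q ^ 2 + (q ^ 1 + 1)))) 2W≡q³ ⟩
  q ^ 3 * (q ^ 3 + (q ^ 2 + (q ^ 1 + 1)))
    ≡⟨ factor q ⟩
  q ^ 4 * (q ^ 2 + q + 1) + q ^ 3 ∎)
  where
  open ≡-Reasoning
  open import Data.Nat.Solver using (module +-*-Solver)
  open +-*-Solver
  expand : ∀ q s e → (s + q) * q ^ 2 + 2 * e * (q ^ 2 + q + 1) + q ^ 3
                     ≡ q ^ 2 * s + 2 * (e * (q ^ 2 + (q ^ 1 + 1)) + q ^ 3)
  expand = solve 3 (λ q s e → (s :+ q) :* q :^ 2 :+ con 2 :* e :* (q :^ 2 :+ q :+ con 1) :+ q :^ 3
                          := q :^ 2 :* s :+ con 2 :* (e :* (q :^ 2 :+ (q :^ 1 :+ con 1)) :+ q :^ 3)) refl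
  collect : ∀ g s t → 2 * g * s + 2 * t ≡ 2 * (t + g * s)
  collect = solve 3 (λ g s t → con 2 :* g :* s :+ con 2 :* t := con 2 :* (t :+ g :* s)) refl
  factor : ∀ q → q ^ 3 * (q ^ 3 + (q ^ 2 + (q ^ 1 + 1))) ≡ q ^ 4 * (q ^ 2 + q + 1) + q ^ 3
  factor = solve 1 (λ q → q :^ 3 :* (q :^ 3 :+ (q :^ 2 :+ (q :^ 1 :+ con 1)))
                        := q :^ 4 :* (q :^ 2 :+ q :+ con 1) :+ q :^ 3) refl

-- Double counting the incidences between the points of a fixed solid a ∈ E and the
-- solids of E: each b ∈ E other than a meets a in a plane (θ 2 points), while a meets
-- itself in θ 3 = q³ + θ 2 points.
module Incidences {q : ℕ} (F : FiniteField q) (E : Vec (FiniteField.Carrier F) 5 → Bool)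
  (a : Vec (FiniteField.Carrier F) 5) (na : PG.normalized F a ≡ true) (ea : E a ≡ true) where
  open FiniteField F using (_≟_)
  open PG F
  open Counting F
  open ≡-Reasoning

  V : List (Vector 5)
  V = allVecs 5

  solidsThroughPoint-Σ : ∀ x →
    solidsThroughPoint E x ≡ Σ V (λ b → [ normalized b ∧ E b ∧ incident b x ])
  solidsThroughPoint-Σ x = length-filter _ V

  covered : ∀ x → incident a x ≡ true → 1 ≤ solidsThroughPoint E x
  covered x ax = subst (1 ≤_) (sym (solidsThroughPoint-Σ x))
    (subst (λ t → [ t ] ≤ _) a-term
      (Vectors.term≤Σ 5 (allVecs-enumerate 5) (λ b → [ normalized b ∧ E b ∧ incident b x ]) a))
    where
    a-term : normalized a ∧ E a ∧ incident a x ≡ true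
    a-term rewrite na | ea | ax = refl

  meet : ∀ b → normalized b ≡ true →
    Σ V (λ x → [ normalized x ∧ incident a x ∧ incident b x ]) ≡ θ 2 + Vectors.δ 5 b a * q ^ 3
  meet b nb with ≡-dec _≟_ b a
  ... | yes refl = begin
    Σ V (λ x → [ normalized x ∧ incident a x ∧ incident a x ])
      ≡⟨ Σ-cong V (λ x → cong (λ t → [ normalized x ∧ t ]) (∧-idem (incident a x))) ⟩
    Σ V (λ x → [ normalized x ∧ incident a x ])                ≡⟨ points-on-hyperplane 3 a na ⟩
    q ^ 3 + θ 2                                                ≡⟨ ℕP.+-comm (q ^ 3) (θ 2) ⟩
    θ 2 + q ^ 3                                                ≡⟨ cong (θ 2 +_) (ℕP.*-identityˡ (q ^ 3)) ⟨
    θ 2 + 1 * q ^ 3                                            ∎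
  ... | no b≢a =
    trans (points-on-two-hyperplanes 2 a b na nb (λ e → b≢a (sym e))) (sym (ℕP.+-identityʳ (θ 2)))

  incidence-count : Σ V (λ x → [ normalized x ∧ incident a x ] * solidsThroughPoint E x)
                    ≡ numSolids E * θ 2 + q ^ 3
  incidence-count = begin
    Σ V (λ x → [ normalized x ∧ incident a x ] * solidsThroughPoint E x)
      ≡⟨ Σ-cong V (λ x → trans (cong ([ normalized x ∧ incident a x ] *_) (solidsThroughPoint-Σ x))
           (sym (Σ-*ˡ V [ normalized x ∧ incident a x ] (λ b → [ normalized b ∧ E b ∧ incident b x ])))) ⟩
    Σ V (λ x → Σ V (λ b → [ normalized x ∧ incident a x ] * [ normalized b ∧ E b ∧ incident b x ]))
      ≡⟨ Σ-swap V V _ ⟩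
    Σ V (λ b → Σ V (λ x → [ normalized x ∧ incident a x ] * [ normalized b ∧ E b ∧ incident b x ]))
      ≡⟨ Σ-cong V (λ b → trans
           (Σ-cong V (λ x → regroup (normalized x) (incident a x) (normalized b) (E b) (incident b x)))
           (Σ-*ˡ V [ normalized b ∧ E b ] _)) ⟩
    Σ V (λ b → [ normalized b ∧ E b ] * Σ V (λ x → [ normalized x ∧ incident a x ∧ incident b x ]))
      ≡⟨ Σ-cong V meet-E ⟩
    Σ V (λ b → [ normalized b ∧ E b ] * θ 2 + [ normalized b ∧ E b ] * (Vectors.δ 5 b a * q ^ 3))
      ≡⟨ Σ-+ V _ _ ⟩
    Σ V (λ b → [ normalized b ∧ E b ] * θ 2)
      + Σ V (λ b → [ normalized b ∧ E b ] * (Vectors.δ 5 b a * q ^ 3))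
      ≡⟨ cong₂ _+_ (trans (Σ-*ʳ V (θ 2) _) (cong (_* θ 2) (sym (length-filter _ V)))) a-itself ⟩
    numSolids E * θ 2 + q ^ 3 ∎
    where
    regroup : ∀ nx ax nb eb bx → [ nx ∧ ax ] * [ nb ∧ eb ∧ bx ] ≡ [ nb ∧ eb ] * [ nx ∧ ax ∧ bx ]
    regroup false ax nb eb bx = sym (ℕP.*-zeroʳ [ nb ∧ eb ])
    regroup true false nb eb bx = sym (ℕP.*-zeroʳ [ nb ∧ eb ])
    regroup true true false eb bx = refl
    regroup true true true false bx = refl
    regroup true true true true bx = refl
    meet-E : ∀ b → [ normalized b ∧ E b ] * Σ V (λ x → [ normalized x ∧ incident a x ∧ incident b x ])
                 ≡ [ normalized b ∧ E b ] * θ 2 + [ normalized b ∧ E b ] * (Vectors.δ 5 b a * q ^ 3)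
    meet-E b with normalized b in nb
    ... | true = trans (cong ([ E b ] *_) (meet b nb)) (ℕP.*-distribˡ-+ [ E b ] _ _)
    ... | false = refl
    a-itself : Σ V (λ b → [ normalized b ∧ E b ] * (Vectors.δ 5 b a * q ^ 3)) ≡ q ^ 3
    a-itself = begin
      Σ V (λ b → [ normalized b ∧ E b ] * (Vectors.δ 5 b a * q ^ 3))
        ≡⟨ Σ-cong V (λ b → *-left-commute [ normalized b ∧ E b ] (Vectors.δ 5 b a) (q ^ 3)) ⟩
      Σ V (λ b → Vectors.δ 5 b a * ([ normalized b ∧ E b ] * q ^ 3))
        ≡⟨ Vectors.sift (allVecs-enumerate 5) (λ b → [ normalized b ∧ E b ] * q ^ 3) a ⟩
      [ normalized a ∧ E a ] * q ^ 3  ≡⟨ cong (λ t → [ t ] * q ^ 3) (cong₂ _∧_ na ea) ⟩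
      1 * q ^ 3                      ≡⟨ ℕP.*-identityˡ (q ^ 3) ⟩
      q ^ 3                          ∎

  two-type-count : ∀ W B G → B + G ≡ W → G ≢ 0 →
    (∀ x → normalized x ≡ true →
      solidsThroughPoint E x ≡ 0 ⊎ solidsThroughPoint E x ≡ W ⊎ solidsThroughPoint E x ≡ B) →
    numSolids E * θ 2 + q ^ 3
      + G * count 5 (λ x → normalized x ∧ incident a x ∧ does (solidsThroughPoint E x ℕ.≟ B))
    ≡ W * θ 3
  two-type-count W B G B+G≡W G≢0 types = begin
    numSolids E * θ 2 + q ^ 3 + G * count 5 (λ x → normalized x ∧ incident a x ∧ typeB x)
      ≡⟨ cong₂ _+_ incidence-count
           (cong (G *_) (sym (length-filter (λ x → normalized x ∧ incident a x ∧ typeB x) V))) ⟨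
    Σ V (λ x → [ on-a x ] * solidsThroughPoint E x)
      + G * Σ V (λ x → [ normalized x ∧ incident a x ∧ typeB x ])
      ≡⟨ cong (Σ V (λ x → [ on-a x ] * solidsThroughPoint E x) +_) (Σ-*ˡ V G _) ⟨
    Σ V (λ x → [ on-a x ] * solidsThroughPoint E x)
      + Σ V (λ x → G * [ normalized x ∧ incident a x ∧ typeB x ])
      ≡⟨ Σ-+ V _ _ ⟨
    Σ V (λ x → [ on-a x ] * solidsThroughPoint E x + G * [ normalized x ∧ incident a x ∧ typeB x ])
      ≡⟨ Σ-cong V pointwise ⟩
    Σ V (λ x → W * [ on-a x ])  ≡⟨ Σ-*ˡ V W _ ⟩
    W * Σ V (λ x → [ on-a x ])  ≡⟨ cong (W *_) (points-on-hyperplane 3 a na) ⟩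
    W * θ 3                     ∎
    where
    on-a : Vector 5 → Bool
    on-a x = normalized x ∧ incident a x
    typeB : Vector 5 → Bool
    typeB x = does (solidsThroughPoint E x ℕ.≟ B)
    -- a point of a is covered by a itself, so it is not of the type 0
    W-or-B : ∀ x → normalized x ≡ true → incident a x ≡ true →
      solidsThroughPoint E x ≡ W ⊎ solidsThroughPoint E x ≡ B
    W-or-B x nx ax with types x nx
    ... | inj₁ none with () ← subst (1 ≤_) none (covered x ax)
    ... | inj₂ W-or-B = W-or-B
    pointwise : ∀ x → [ on-a x ] * solidsThroughPoint E x + G * [ normalized x ∧ incident a x ∧ typeB x ]
                      ≡ W * [ on-a x ]
    pointwise x with normalized x in nx | incident a x in ax
    ... | false | _ = trans (ℕP.*-zeroʳ G) (sym (ℕP.*-zeroʳ W))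
    ... | true | false = trans (ℕP.*-zeroʳ G) (sym (ℕP.*-zeroʳ W))
    ... | true | true = trans (cong (_+ G * [ typeB x ]) (ℕP.+-identityʳ _))
                          (trans (two-values B+G≡W G≢0 (W-or-B x nx ax)) (sym (ℕP.*-identityʳ W)))

-- Integer notation is opened only here: its prefix +_ clashes with sections (n +_) on ℕ.
open import Data.Nat.Divisibility using (_∣_; divides)
open import Data.Nat using (_<_; _∸_; _/_)
open import Data.Integer using (+_)
import Data.Integer as ℤ
import Data.Integer.Properties as ℤP

to-ℤ : ∀ s q Q2 Q4 e t → (s + q) * Q2 + 2 * e * t ≡ Q4 * t →
  (+ s ℤ.+ + q) ℤ.* + Q2 ≡ (+ Q4 ℤ.- + (2 * e)) ℤ.* + t
to-ℤ s q Q2 Q4 e t eq = begin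
  (+ s ℤ.+ + q) ℤ.* + Q2                      ≡⟨ cong (ℤ._* + Q2) (ℤP.pos-+ s q) ⟨
  + (s + q) ℤ.* + Q2                          ≡⟨ ℤP.pos-* (s + q) Q2 ⟨
  + ((s + q) * Q2)                            ≡⟨ add-sub (+ ((s + q) * Q2)) (+ (2 * e * t)) ⟩
  + ((s + q) * Q2) ℤ.+ + (2 * e * t) ℤ.- + (2 * e * t)
    ≡⟨ cong (ℤ._- + (2 * e * t)) (ℤP.pos-+ _ (2 * e * t)) ⟨
  + ((s + q) * Q2 + 2 * e * t) ℤ.- + (2 * e * t)
    ≡⟨ cong₂ ℤ._-_ (trans (cong +_ eq) (ℤP.pos-* Q4 t)) (ℤP.pos-* (2 * e) t) ⟩
  + Q4 ℤ.* + t ℤ.- + (2 * e) ℤ.* + t          ≡⟨ sub-distrib (+ Q4) (+ (2 * e)) (+ t) ⟩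
  (+ Q4 ℤ.- + (2 * e)) ℤ.* + t                ∎
  where
  open ≡-Reasoning
  open import Data.Integer.Solver using (module +-*-Solver)
  open +-*-Solver
  add-sub : ∀ x y → x ≡ x ℤ.+ y ℤ.- y
  add-sub = solve 2 (λ x y → x := x :+ y :- y) refl
  sub-distrib : ∀ x y z → x ℤ.* z ℤ.- y ℤ.* z ≡ (x ℤ.- y) ℤ.* z
  sub-distrib = solve 3 (λ x y z → x :* z :- y :* z := (x :- y) :* z) refl

lemma2p2 : (q : ℕ) → (F : FiniteField q) → 2 ∣ q → 2 < q →
    (E : Vec (FiniteField.Carrier F) 5 → Bool) →
    (∀ x → PG.normalized F x ≡ true →
    (PG.solidsThroughPoint F E x ≡ 0)
    ⊎ (PG.solidsThroughPoint F E x ≡ (q ^ 3) / 2)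
    ⊎ (PG.solidsThroughPoint F E x ≡ (q ^ 3 ∸ q ^ 2) / 2)) →
    (∀ u v w → PG.Independent3 F u v w →
    (PG.solidsThroughPlane F E u v w ≡ 0)
    ⊎ (PG.solidsThroughPlane F E u v w ≡ q / 2)
    ⊎ (PG.solidsThroughPlane F E u v w ≡ q)) →
    ∀ a → PG.normalized F a ≡ true → E a ≡ true →
    (Data.Integer._*_ (Data.Integer._+_ (+ PG.blackPointsIn F E a) (+ q)) (+ (q ^ 2)))
    ≡ Data.Integer._*_ (Data.Integer._-_ (+ (q ^ 4)) (+ (2 * PG.numSolids F E)))
    (+ (q ^ 2 + q + 1))
lemma2p2 .(zero * 2) F (divides zero refl) ()
lemma2p2 .(suc k * 2) F (divides (suc k) refl) _ E point-types _ a na ea =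
  to-ℤ s q (q ^ 2) (q ^ 4) e (q ^ 2 + q + 1)
    (rearrange q s e W G 2W≡q³ 2G≡q²
      (Incidences.two-type-count F E a na ea W B G B+G≡W G-nonzero point-types))
  where
  open EvenOrder (suc k)
  s e : ℕ
  s = PG.blackPointsIn F E a
  e = PG.numSolids F E
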